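{- Let $a,b,c,d$ be integers with $a^2+b^2+c^2=3d^2$, $d$ an odd positive integer and $\gcd(a,b,c)=1$, and put $q=a^2+b^2$. Then there exists a pair $(r,s)\in\mathbb{Z}^2$ with $2(a^2+b^2)=s^2+3r^2$ such that all twelve of the following numbers are integers: $$m_x=-\frac{db(3r+s)+ac(r-s)}{2q},\quad n_x=-\frac{rac+dbs}{q},\quad m_y=\frac{da(3r+s)-bc(r-s)}{2q},\quad n_y=\frac{das-bcr}{q},$$ $$m_z=\frac{r-s}{2},\quad n_z=r,\quad m_u=-\frac{rac+dbs}{q},\quad n_u=-\frac{db(s-3r)+ac(r+s)}{2q},$$ $$m_v=\frac{das-rbc}{q},\quad n_v=\frac{da(s-3r)-bc(r+s)}{2q},\quad m_w=r,\quad n_w=\frac{r+s}{2}.$$ -}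

-- Work in the Eisenstein integers ℤ[ω], where √−3 = 1 + 2ω and the norm of
-- (u + w√−3)/2 is (u² + 3w²)/4.  Squares modulo 4 force a, b, c, d to be odd, so m = q/2,
-- α = (a² + c²)/2, β = (b² + c²)/2 are integers and g₁ = (bc + ad√−3)/2, g₂ = (−ac + bd√−3)/2
-- lie in ℤ[ω].  Using a² + b² + c² = 3d² one finds N g₁ = mα, N g₂ = mβ and g₁ḡ₂ ∈ mℤ[ω], so m
-- divides every product g ḡ′ of generators of the ideal (m, g₁, g₂).  Since ℤ[ω] is Euclidean this
-- ideal is principal, say (v); then m ∣ N v, while N v divides N m = m², N g₁ and N g₂, so N v / m
-- divides m, α, β and hence a², b², c²; as gcd(a, b, c) = 1, N v = m.  Writing 2v = s + r√−3, the
-- twelve numbers are, up to sign, coordinates of (bc + ad√−3)v̄/q and (−ac + bd√−3)v̄/q, which are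
-- integral because m divides g₁v̄ and g₂v̄.

module Submission where

open import Algebra.Bundles using (CommutativeRing)
open import Algebra.Consequences.Propositional using (comm∧distrʳ⇒distrˡ; comm∧idˡ⇒idʳ)
open import Algebra.Structures using (IsCommutativeRing)
open import Data.Empty using (⊥-elim)
open import Data.Integer
  using (ℤ; +_; -[1+_]; +[1+_]; 0ℤ; 1ℤ; _+_; _-_; _*_; -_; _<_; _≤_; ∣_∣; +<+; +≤+; _/_; _%_;
         NonZero; nonNegative; ≢-nonZero)
open import Data.Integer.Divisibility using (_∣_)
import Data.Integer.Divisibility.Signed as Signed
open import Data.Integer.DivMod using (a≡a%n+[a/n]*n; n%d<d)
open import Data.Integer.GCD using (gcd; gcd-greatest)
import Data.Integer.Properties as ℤ
open import Data.Integer.Tactic.RingSolver using (solve-∀)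
open import Data.List using (List; []; _∷_)
open import Data.List.Membership.Propositional using (_∈_)
open import Data.List.Relation.Unary.All as All using (All; []; _∷_)
open import Data.List.Relation.Unary.Any using (here; there)
import Data.Nat as ℕ
open import Data.Nat using (suc; z≤n; s≤s)
open import Data.Nat.Base using (nonTrivial⇒≢1)
import Data.Nat.Divisibility as ℕ
open import Data.Nat.DivMod using (m≡m%n+[m/n]*n; m%n<n; [m+kn]%n≡m%n; %-distribˡ-+; %-distribˡ-*; m%n%n≡m%n)
open import Data.Nat.Induction using (<-wellFounded)
open import Data.Nat.ListAction using (product)
open import Data.Nat.Primality using (Prime; prime[2]; prime⇒nonTrivial; euclidsLemma)
open import Data.Nat.Primality.Factorisation using (factorise)
import Data.Nat.Properties as ℕ
import Data.Nat.Tactic.RingSolver as ℕ-Solver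
open import Data.Product using (_×_; _,_; ∃; ∃₂; proj₁)
open import Data.Sum using (inj₁; inj₂)
open import Function using (_on_)
open import Induction.WellFounded using (WellFounded; Acc; acc)
open import Level using (0ℓ)
import Relation.Binary.Construct.On as On
open import Relation.Binary.PropositionalEquality
open import Relation.Nullary using (¬_; yes; no)
open import Relation.Nullary.Decidable using (decidable-stable)

-- The Eisenstein integers

-- x +ω y stands for x + yω, where ω² = −1 − ω.
infix 5 _+ω_
record ℤ[ω] : Set where
  constructor _+ω_
  field
    re im : ℤ

infixl 6 _+ₑ_ _-ₑ_
infixl 7 _*ₑ_
infix 8 -ₑ_

_+ₑ_ : ℤ[ω] → ℤ[ω] → ℤ[ω]
(x +ω y) +ₑ (x′ +ω y′) = x + x′ +ω y + y′

-ₑ_ : ℤ[ω] → ℤ[ω]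
-ₑ (x +ω y) = - x +ω - y

_-ₑ_ : ℤ[ω] → ℤ[ω] → ℤ[ω]
z -ₑ w = z +ₑ -ₑ w

_*ₑ_ : ℤ[ω] → ℤ[ω] → ℤ[ω]
(x +ω y) *ₑ (x′ +ω y′) = x * x′ - y * y′ +ω x * y′ + y * x′ - y * y′

0ₑ 1ₑ : ℤ[ω]
0ₑ = 0ℤ +ω 0ℤ
1ₑ = 1ℤ +ω 0ℤ

+ₑ-assoc : ∀ z w u → (z +ₑ w) +ₑ u ≡ z +ₑ (w +ₑ u)
+ₑ-assoc (x +ω y) (x′ +ω y′) (x″ +ω y″) = cong₂ _+ω_ (ℤ.+-assoc x x′ x″) (ℤ.+-assoc y y′ y″)

+ₑ-identityˡ : ∀ z → 0ₑ +ₑ z ≡ z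
+ₑ-identityˡ (x +ω y) = cong₂ _+ω_ (ℤ.+-identityˡ x) (ℤ.+-identityˡ y)

+ₑ-identityʳ : ∀ z → z +ₑ 0ₑ ≡ z
+ₑ-identityʳ (x +ω y) = cong₂ _+ω_ (ℤ.+-identityʳ x) (ℤ.+-identityʳ y)

+ₑ-inverseˡ : ∀ z → -ₑ z +ₑ z ≡ 0ₑ
+ₑ-inverseˡ (x +ω y) = cong₂ _+ω_ (ℤ.+-inverseˡ x) (ℤ.+-inverseˡ y)

+ₑ-inverseʳ : ∀ z → z +ₑ -ₑ z ≡ 0ₑ
+ₑ-inverseʳ (x +ω y) = cong₂ _+ω_ (ℤ.+-inverseʳ x) (ℤ.+-inverseʳ y)

+ₑ-comm : ∀ z w → z +ₑ w ≡ w +ₑ z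
+ₑ-comm (x +ω y) (x′ +ω y′) = cong₂ _+ω_ (ℤ.+-comm x x′) (ℤ.+-comm y y′)

*ₑ-assoc : ∀ z w u → (z *ₑ w) *ₑ u ≡ z *ₑ (w *ₑ u)
*ₑ-assoc (a +ω b) (c +ω d) (e +ω f) = cong₂ _+ω_ (re-eq a b c d e f) (im-eq a b c d e f)
  where
  re-eq : ∀ a b c d e f → (a * c - b * d) * e - (a * d + b * c - b * d) * f
                        ≡ a * (c * e - d * f) - b * (c * f + d * e - d * f)
  re-eq = solve-∀
  im-eq : ∀ a b c d e f → (a * c - b * d) * f + (a * d + b * c - b * d) * e - (a * d + b * c - b * d) * f
                        ≡ a * (c * f + d * e - d * f) + b * (c * e - d * f) - b * (c * f + d * e - d * f)
  im-eq = solve-∀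

*ₑ-identityˡ : ∀ z → 1ₑ *ₑ z ≡ z
*ₑ-identityˡ (x +ω y) = cong₂ _+ω_ (re-eq x y) (im-eq x y)
  where
  re-eq : ∀ x y → 1ℤ * x - 0ℤ * y ≡ x
  re-eq = solve-∀
  im-eq : ∀ x y → 1ℤ * y + 0ℤ * x - 0ℤ * y ≡ y
  im-eq = solve-∀

*ₑ-comm : ∀ z w → z *ₑ w ≡ w *ₑ z
*ₑ-comm (a +ω b) (c +ω d) = cong₂ _+ω_ (re-eq a b c d) (im-eq a b c d)
  where
  re-eq : ∀ a b c d → a * c - b * d ≡ c * a - d * b
  re-eq = solve-∀
  im-eq : ∀ a b c d → a * d + b * c - b * d ≡ c * b + d * a - d * b
  im-eq = solve-∀

*ₑ-distribʳ-+ₑ : ∀ u z w → (z +ₑ w) *ₑ u ≡ z *ₑ u +ₑ w *ₑ u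
*ₑ-distribʳ-+ₑ (e +ω f) (a +ω b) (c +ω d) = cong₂ _+ω_ (re-eq a b c d e f) (im-eq a b c d e f)
  where
  re-eq : ∀ a b c d e f → (a + c) * e - (b + d) * f ≡ a * e - b * f + (c * e - d * f)
  re-eq = solve-∀
  im-eq : ∀ a b c d e f → (a + c) * f + (b + d) * e - (b + d) * f ≡ a * f + b * e - b * f + (c * f + d * e - d * f)
  im-eq = solve-∀

ℤ[ω]-isCommutativeRing : IsCommutativeRing _≡_ _+ₑ_ _*ₑ_ -ₑ_ 0ₑ 1ₑ
ℤ[ω]-isCommutativeRing = record
  { isRing = record
    { +-isAbelianGroup = record
      { isGroup = record
        { isMonoid = record
          { isSemigroup = record
            { isMagma = record { isEquivalence = isEquivalence ; ∙-cong = cong₂ _+ₑ_ }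
            ; assoc = +ₑ-assoc
            }
          ; identity = +ₑ-identityˡ , +ₑ-identityʳ
          }
        ; inverse = +ₑ-inverseˡ , +ₑ-inverseʳ
        ; ⁻¹-cong = cong (-ₑ_)
        }
      ; comm = +ₑ-comm
      }
    ; *-cong = cong₂ _*ₑ_
    ; *-assoc = *ₑ-assoc
    ; *-identity = *ₑ-identityˡ , comm∧idˡ⇒idʳ *ₑ-comm *ₑ-identityˡ
    ; distrib = comm∧distrʳ⇒distrˡ *ₑ-comm *ₑ-distribʳ-+ₑ , *ₑ-distribʳ-+ₑ
    }
  ; *-comm = *ₑ-comm
  }

ℤ[ω]-commutativeRing : CommutativeRing 0ℓ 0ℓ
ℤ[ω]-commutativeRing = record { isCommutativeRing = ℤ[ω]-isCommutativeRing }

module R = CommutativeRing ℤ[ω]-commutativeRing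
open import Algebra.Properties.CommutativeSemigroup R.*-commutativeSemigroup using (x∙yz≈y∙xz; interchange)
open import Algebra.Properties.CommutativeSemigroup.Divisibility R.*-commutativeSemigroup using (x∣y⇒zx∣zy)
open import Algebra.Properties.Group R.+-group using (//-rightDividesˡ)
open import Algebra.Properties.Ring R.ring using (-‿distribˡ-*)
open import Algebra.Properties.Semiring.Divisibility R.semiring
  using (_,_; ∣ʳ-refl; ∣ʳ-trans; x∣ʳy⇒x∣ʳzy; _∣0) renaming (_∣_ to _∣ₑ_)

conj : ℤ[ω] → ℤ[ω]
conj (x +ω y) = x - y +ω - y

N : ℤ[ω] → ℤ
N (x +ω y) = x * x - x * y + y * y

ι : ℤ → ℤ[ω]
ι k = k +ω 0ℤ

-- ⟪ u , w ⟫ is u + w√−3.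
⟪_,_⟫ : ℤ → ℤ → ℤ[ω]
⟪ u , w ⟫ = u + w +ω + 2 * w

conj-+ₑ : ∀ z w → conj (z +ₑ w) ≡ conj z +ₑ conj w
conj-+ₑ (a +ω b) (c +ω d) = cong₂ _+ω_ (re-eq a b c d) (ℤ.neg-distrib-+ b d)
  where
  re-eq : ∀ a b c d → a + c - (b + d) ≡ a - b + (c - d)
  re-eq = solve-∀

conj-*ₑ : ∀ z w → conj (z *ₑ w) ≡ conj z *ₑ conj w
conj-*ₑ (a +ω b) (c +ω d) = cong₂ _+ω_ (re-eq a b c d) (im-eq a b c d)
  where
  re-eq : ∀ a b c d → a * c - b * d - (a * d + b * c - b * d) ≡ (a - b) * (c - d) - (- b) * (- d)
  re-eq = solve-∀
  im-eq : ∀ a b c d → - (a * d + b * c - b * d) ≡ (a - b) * (- d) + (- b) * (c - d) - (- b) * (- d)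
  im-eq = solve-∀

conj-involutive : ∀ z → conj (conj z) ≡ z
conj-involutive (x +ω y) = cong₂ _+ω_ (re-eq x y) (ℤ.neg-involutive y)
  where
  re-eq : ∀ x y → x - y - (- y) ≡ x
  re-eq = solve-∀

conj-ι : ∀ k → conj (ι k) ≡ ι k
conj-ι k = cong₂ _+ω_ (ℤ.+-identityʳ k) refl

conj-*ₑ-conj : ∀ z w → conj (z *ₑ conj w) ≡ w *ₑ conj z
conj-*ₑ-conj z w = trans (conj-*ₑ z (conj w)) (trans (cong (conj z *ₑ_) (conj-involutive w)) (R.*-comm (conj z) w))

*ₑ-conj≡ιN : ∀ z → z *ₑ conj z ≡ ι (N z)
*ₑ-conj≡ιN (x +ω y) = cong₂ _+ω_ (re-eq x y) (im-eq x y)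
  where
  re-eq : ∀ x y → x * (x - y) - y * (- y) ≡ x * x - x * y + y * y
  re-eq = solve-∀
  im-eq : ∀ x y → x * (- y) + y * (x - y) - y * (- y) ≡ 0ℤ
  im-eq = solve-∀

N-*ₑ : ∀ z w → N (z *ₑ w) ≡ N z * N w
N-*ₑ (a +ω b) (c +ω d) = identity a b c d
  where
  identity : ∀ a b c d →
    (a * c - b * d) * (a * c - b * d) - (a * c - b * d) * (a * d + b * c - b * d)
      + (a * d + b * c - b * d) * (a * d + b * c - b * d)
    ≡ (a * a - a * b + b * b) * (c * c - c * d + d * d)
  identity = solve-∀

N-conj : ∀ z → N (conj z) ≡ N z
N-conj (x +ω y) = identity x y
  where
  identity : ∀ x y → (x - y) * (x - y) - (x - y) * (- y) + (- y) * (- y) ≡ x * x - x * y + y * y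
  identity = solve-∀

N-ι : ∀ k → N (ι k) ≡ k * k
N-ι k = identity k
  where
  identity : ∀ k → k * k - k * 0ℤ + 0ℤ * 0ℤ ≡ k * k
  identity = solve-∀

ι-scale : ∀ k x y → ι k *ₑ (x +ω y) ≡ k * x +ω k * y
ι-scale k x y = cong₂ _+ω_ (re-eq k x y) (im-eq k x y)
  where
  re-eq : ∀ k x y → k * x - 0ℤ * y ≡ k * x
  re-eq = solve-∀
  im-eq : ∀ k x y → k * y + 0ℤ * x - 0ℤ * y ≡ k * y
  im-eq = solve-∀

ι-* : ∀ j k → ι (j * k) ≡ ι j *ₑ ι k
ι-* j k = trans (cong₂ _+ω_ refl (sym (ℤ.*-zeroʳ j))) (sym (ι-scale j k 0ℤ))

ι-*ₑ-cancel : ∀ {k} z w → k ≢ 0ℤ → ι k *ₑ z ≡ ι k *ₑ w → z ≡ w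
ι-*ₑ-cancel {k} (x +ω y) (x′ +ω y′) k≢0 kz≡kw =
  cong₂ _+ω_ (ℤ.*-cancelˡ-≡ k x x′ {{≢-nonZero k≢0}} (cong ℤ[ω].re kz≡kw′))
             (ℤ.*-cancelˡ-≡ k y y′ {{≢-nonZero k≢0}} (cong ℤ[ω].im kz≡kw′))
  where
  kz≡kw′ : k * x +ω k * y ≡ k * x′ +ω k * y′
  kz≡kw′ = trans (sym (ι-scale k x y)) (trans kz≡kw (ι-scale k x′ y′))

2z≡⟪⟫ : ∀ x y → ι (+ 2) *ₑ (x +ω y) ≡ ⟪ + 2 * x - y , y ⟫
2z≡⟪⟫ x y = trans (ι-scale (+ 2) x y) (cong₂ _+ω_ (re-eq x y) refl)
  where
  re-eq : ∀ x y → + 2 * x ≡ + 2 * x - y + y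
  re-eq = solve-∀

N-⟪⟫ : ∀ u w → N ⟪ u , w ⟫ ≡ u * u + + 3 * (w * w)
N-⟪⟫ u w = identity u w
  where
  identity : ∀ u w → (u + w) * (u + w) - (u + w) * (+ 2 * w) + + 2 * w * (+ 2 * w) ≡ u * u + + 3 * (w * w)
  identity = solve-∀

ι-⟪⟫ : ∀ k u w → ι k *ₑ ⟪ u , w ⟫ ≡ ⟪ k * u , k * w ⟫
ι-⟪⟫ k u w = trans (ι-scale k (u + w) (+ 2 * w)) (cong₂ _+ω_ (re-eq k u w) (im-eq k w))
  where
  re-eq : ∀ k u w → k * (u + w) ≡ k * u + k * w
  re-eq = solve-∀
  im-eq : ∀ k w → k * (+ 2 * w) ≡ + 2 * (k * w)
  im-eq = solve-∀

⟪⟫-*ₑ-conj : ∀ u w u′ w′ → ⟪ u , w ⟫ *ₑ conj ⟪ u′ , w′ ⟫ ≡ ⟪ u * u′ + + 3 * (w * w′) , w * u′ - u * w′ ⟫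
⟪⟫-*ₑ-conj u w u′ w′ = cong₂ _+ω_ (re-eq u w u′ w′) (im-eq u w u′ w′)
  where
  re-eq : ∀ u w u′ w′ → (u + w) * (u′ + w′ - + 2 * w′) - + 2 * w * (- (+ 2 * w′))
                      ≡ u * u′ + + 3 * (w * w′) + (w * u′ - u * w′)
  re-eq = solve-∀
  im-eq : ∀ u w u′ w′ → (u + w) * (- (+ 2 * w′)) + + 2 * w * (u′ + w′ - + 2 * w′) - + 2 * w * (- (+ 2 * w′))
                      ≡ + 2 * (w * u′ - u * w′)
  im-eq = solve-∀

double-*ₑ : ∀ z w → ι (+ 2) *ₑ z *ₑ (ι (+ 2) *ₑ w) ≡ ι (+ 4) *ₑ (z *ₑ w)
double-*ₑ z w = interchange (ι (+ 2)) z (ι (+ 2)) w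

conj-double : ∀ z → conj (ι (+ 2) *ₑ z) ≡ ι (+ 2) *ₑ conj z
conj-double z = trans (conj-*ₑ (ι (+ 2)) z) (cong (_*ₑ conj z) (conj-ι (+ 2)))

N-half : ∀ z u w → ι (+ 2) *ₑ z ≡ ⟪ u , w ⟫ → + 4 * N z ≡ u * u + + 3 * (w * w)
N-half z u w 2z≡⟪u,w⟫ = begin
  + 4 * N z              ≡⟨ N-*ₑ (ι (+ 2)) z ⟨
  N (ι (+ 2) *ₑ z)       ≡⟨ cong N 2z≡⟪u,w⟫ ⟩
  N ⟪ u , w ⟫            ≡⟨ N-⟪⟫ u w ⟩
  u * u + + 3 * (w * w)  ∎
  where open ≡-Reasoning

N-half≡ : ∀ g u w {p r} → ι (+ 2) *ₑ g ≡ ⟪ u , w ⟫ →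
          u * u + + 3 * (w * w) ≡ + 2 * p * (+ 2 * r) → N g ≡ p * r
N-half≡ g u w {p} {r} 2g≡ N⟪u,w⟫≡4pr = ℤ.*-cancelˡ-≡ (+ 4) (N g) (p * r) (begin
  + 4 * N g               ≡⟨ N-half g u w 2g≡ ⟩
  u * u + + 3 * (w * w)   ≡⟨ N⟪u,w⟫≡4pr ⟩
  + 2 * p * (+ 2 * r)     ≡⟨ identity p r ⟩
  + 4 * (p * r)           ∎)
  where
  open ≡-Reasoning
  identity : ∀ p r → + 2 * p * (+ 2 * r) ≡ + 4 * (p * r)
  identity = solve-∀

∣ₑ-+ₑ : ∀ {x y z} → x ∣ₑ y → x ∣ₑ z → x ∣ₑ y +ₑ z
∣ₑ-+ₑ {x} (p , refl) (q , refl) = p +ₑ q , R.distribʳ x p q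

N-∣ : ∀ {g} z → g ∣ₑ z → N g Signed.∣ N z
N-∣ {g} _ (l , refl) = Signed.divides (N l) (N-*ₑ l g)

ι∣⇒ι∣conj : ∀ {k} z → ι k ∣ₑ z → ι k ∣ₑ conj z
ι∣⇒ι∣conj {k} _ (l , refl) = conj l , trans (cong (conj l *ₑ_) (sym (conj-ι k))) (sym (conj-*ₑ l (ι k)))

ι∣⇒∣components : ∀ {k} x y → ι k ∣ₑ (x +ω y) → k Signed.∣ x × k Signed.∣ y
ι∣⇒∣components {k} x y (l₁ +ω l₂ , l*k≡x+yω) =
  Signed.divides l₁ (trans (cong ℤ[ω].re (sym l*k≡x+yω)) (re-eq l₁ l₂ k)) ,
  Signed.divides l₂ (trans (cong ℤ[ω].im (sym l*k≡x+yω)) (im-eq l₁ l₂ k))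
  where
  re-eq : ∀ l₁ l₂ k → l₁ * k - l₂ * 0ℤ ≡ l₁ * k
  re-eq = solve-∀
  im-eq : ∀ l₁ l₂ k → l₁ * 0ℤ + l₂ * k - l₂ * 0ℤ ≡ l₂ * k
  im-eq = solve-∀

∣N⇒ι∣*ₑ-conj : ∀ {k} z → k Signed.∣ N z → ι k ∣ₑ z *ₑ conj z
∣N⇒ι∣*ₑ-conj {k} z (Signed.divides l Nz≡lk) =
  ι l , trans (sym (ι-* l k)) (trans (cong ι (sym Nz≡lk)) (sym (*ₑ-conj≡ιN z)))

⟪⟫-*ₑ-conj-∣ : ∀ {k} u w z s r → ι (+ 2) *ₑ z ≡ ⟪ s , r ⟫ → ι k ∣ₑ ⟪ u , w ⟫ *ₑ conj z →
               let U = u * s + + 3 * (w * r)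
                   W = w * s - u * r
               in k Signed.∣ W × + 2 * k Signed.∣ U + W × + 2 * k Signed.∣ W - U
⟪⟫-*ₑ-conj-∣ {k} u w z s r 2z≡⟪s,r⟫ k∣P =
  let k∣X , k∣Y = ι∣⇒∣components X Y k∣P
      2k∣2X = Signed.*-monoʳ-∣ (+ 2) k∣X
      2k∣2Y = Signed.*-monoʳ-∣ (+ 2) k∣Y
  in subst (k Signed.∣_) (ℤ.*-cancelˡ-≡ (+ 2) Y W 2Y≡2W) k∣Y ,
     subst (+ 2 * k Signed.∣_) 2X≡U+W 2k∣2X ,
     subst (+ 2 * k Signed.∣_) (trans (cong₂ _-_ 2Y≡2W 2X≡U+W) (identity U W)) (Signed.∣m∣n⇒∣m-n 2k∣2Y 2k∣2X)
  where
  P = ⟪ u , w ⟫ *ₑ conj z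
  X = ℤ[ω].re P
  Y = ℤ[ω].im P
  U = u * s + + 3 * (w * r)
  W = w * s - u * r
  2P≡⟪U,W⟫ : + 2 * X +ω + 2 * Y ≡ ⟪ U , W ⟫
  2P≡⟪U,W⟫ = begin
    + 2 * X +ω + 2 * Y                ≡⟨ ι-scale (+ 2) X Y ⟨
    ι (+ 2) *ₑ P                      ≡⟨ x∙yz≈y∙xz (ι (+ 2)) ⟪ u , w ⟫ (conj z) ⟩
    ⟪ u , w ⟫ *ₑ (ι (+ 2) *ₑ conj z)  ≡⟨ cong (⟪ u , w ⟫ *ₑ_) (conj-double z) ⟨
    ⟪ u , w ⟫ *ₑ conj (ι (+ 2) *ₑ z)  ≡⟨ cong (λ t → ⟪ u , w ⟫ *ₑ conj t) 2z≡⟪s,r⟫ ⟩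
    ⟪ u , w ⟫ *ₑ conj ⟪ s , r ⟫       ≡⟨ ⟪⟫-*ₑ-conj u w s r ⟩
    ⟪ U , W ⟫                         ∎
    where open ≡-Reasoning
  2X≡U+W : + 2 * X ≡ U + W
  2X≡U+W = cong ℤ[ω].re 2P≡⟪U,W⟫
  2Y≡2W : + 2 * Y ≡ + 2 * W
  2Y≡2W = cong ℤ[ω].im 2P≡⟪U,W⟫
  identity : ∀ U W → + 2 * W - (U + W) ≡ W - U
  identity = solve-∀

-- Positivity of the norm and Euclidean division

square-abs : ∀ x → + (∣ x ∣ ℕ.* ∣ x ∣) ≡ x * x
square-abs (+ ℕ.zero) = refl
square-abs +[1+ n ] = refl
square-abs -[1+ n ] = refl

0≤i*i : ∀ x → 0ℤ ≤ x * x
0≤i*i x = subst (0ℤ ≤_) (square-abs x) (+≤+ z≤n)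

i*i≡0⇒i≡0 : ∀ x → x * x ≡ 0ℤ → x ≡ 0ℤ
i*i≡0⇒i≡0 x x²≡0 with ℤ.i*j≡0⇒i≡0∨j≡0 x x²≡0
... | inj₁ x≡0 = x≡0
... | inj₂ x≡0 = x≡0

nonneg-+≡0⇒≡0 : ∀ {i j} → 0ℤ ≤ i → 0ℤ ≤ j → i + j ≡ 0ℤ → i ≡ 0ℤ
nonneg-+≡0⇒≡0 {i} {j} 0≤i 0≤j i+j≡0 =
  ℤ.≤-antisym (subst (i ≤_) i+j≡0 (ℤ.i≤i+j i j {{nonNegative 0≤j}})) 0≤i

0≤3*i*i : ∀ x → 0ℤ ≤ + 3 * (x * x)
0≤3*i*i x = ℤ.*-monoˡ-≤-nonNeg (+ 3) (0≤i*i x)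

0≤N : ∀ z → 0ℤ ≤ N z
0≤N (x +ω y) = ℤ.*-cancelˡ-≤-pos 0ℤ (N (x +ω y)) (+ 4)
  (subst (0ℤ ≤_) (sym (N-half (x +ω y) (+ 2 * x - y) y (2z≡⟪⟫ x y)))
         (ℤ.+-mono-≤ (0≤i*i (+ 2 * x - y)) (0≤3*i*i y)))

N≡0⇒≡0ₑ : ∀ z → N z ≡ 0ℤ → z ≡ 0ₑ
N≡0⇒≡0ₑ (x +ω y) Nz≡0 = cong₂ _+ω_ x≡0 y≡0
  where
  u = + 2 * x - y
  sum≡0 : u * u + + 3 * (y * y) ≡ 0ℤ
  sum≡0 = trans (sym (N-half (x +ω y) u y (2z≡⟪⟫ x y))) (cong (+ 4 *_) Nz≡0)
  u≡0 : u ≡ 0ℤ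
  u≡0 = i*i≡0⇒i≡0 u (nonneg-+≡0⇒≡0 (0≤i*i u) (0≤3*i*i y) sum≡0)
  y≡0 : y ≡ 0ℤ
  y≡0 = i*i≡0⇒i≡0 y (ℤ.*-cancelˡ-≡ (+ 3) (y * y) 0ℤ
          (nonneg-+≡0⇒≡0 (0≤3*i*i y) (0≤i*i u) (trans (ℤ.+-comm (+ 3 * (y * y)) (u * u)) sum≡0)))
  x≡0 : x ≡ 0ℤ
  x≡0 = ℤ.*-cancelˡ-≡ (+ 2) x 0ℤ (trans (sym (identity x y)) (cong₂ _+_ u≡0 y≡0))
    where
    identity : ∀ x y → + 2 * x - y + y ≡ + 2 * x
    identity = solve-∀

infix 4 _≺_
_≺_ : ℤ[ω] → ℤ[ω] → Set
_≺_ = ℕ._<_ on (λ z → ∣ N z ∣)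

≺-wellFounded : WellFounded _≺_
≺-wellFounded = On.wellFounded (λ z → ∣ N z ∣) <-wellFounded

N-<⇒≺ : ∀ z w → N z < N w → z ≺ w
N-<⇒≺ z w Nz<Nw = ℤ.drop‿+<+ (subst₂ _<_ (abs-N z) (abs-N w) Nz<Nw)
  where
  abs-N : ∀ z → N z ≡ + ∣ N z ∣
  abs-N z = sym (ℤ.0≤i⇒+∣i∣≡i (0≤N z))

N-swap : ∀ x y → N (x +ω y) ≡ N (y +ω x)
N-swap x y = identity x y
  where
  identity : ∀ x y → x * x - x * y + y * y ≡ y * y - y * x + x * x
  identity = solve-∀

N≤square : ∀ {x y} → 0ℤ ≤ x → x ≤ y → N (x +ω y) ≤ y * y
N≤square {x} {y} 0≤x x≤y = begin
  N (x +ω y)            ≡⟨ identity x y ⟩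
  y * y - (y - x) * x   ≤⟨ ℤ.i-j≤i (y * y) ((y - x) * x) {{nonNegative 0≤[y-x]x}} ⟩
  y * y                 ∎
  where
  open ℤ.≤-Reasoning
  identity : ∀ x y → x * x - x * y + y * y ≡ y * y - (y - x) * x
  identity = solve-∀
  0≤[y-x]x : 0ℤ ≤ (y - x) * x
  0≤[y-x]x = ℤ.*-monoʳ-≤-nonNeg x {{nonNegative 0≤x}} (ℤ.i≤j⇒0≤j-i x≤y)

square-< : ∀ {m n} → m ℕ.< n → + m * + m < + n * + n
square-< {m} {n} m<n = subst₂ _<_ (ℤ.pos-* m m) (ℤ.pos-* n n) (+<+ (ℕ.*-mono-< m<n m<n))

remainder-bound : ∀ {n r r′} → r ℕ.< n → r′ ℕ.< n → N (+ r +ω + r′) < + n * + n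
remainder-bound {n} {r} {r′} r<n r′<n with ℕ.≤-total r r′
... | inj₁ r≤r′ = ℤ.≤-<-trans (N≤square (+≤+ z≤n) (+≤+ r≤r′)) (square-< r′<n)
... | inj₂ r′≤r = ℤ.≤-<-trans (ℤ.≤-trans (ℤ.≤-reflexive (N-swap (+ r) (+ r′))) (N≤square (+≤+ z≤n) (+≤+ r′≤r)))
                              (square-< r<n)

division : ∀ z w → N w ≢ 0ℤ → ∃ λ k → z -ₑ k *ₑ w ≺ w
division z w Nw≢0 with z *ₑ conj w in zw̄≡XY
... | X +ω Y = k , N-<⇒≺ ρ w (ℤ.*-cancelʳ-<-nonNeg n {{nonNegative (0≤N w)}} bound)
  where
  n = N w
  instance
    n≢0 : NonZero n
    n≢0 = ≢-nonZero Nw≢0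
  k = X / n +ω Y / n
  ρ = z -ₑ k *ₑ w
  remainder : ∀ a → a - n * (a / n) ≡ + (a % n)
  remainder a = trans (cong (_- n * (a / n)) (a≡a%n+[a/n]*n a n)) (identity (+ (a % n)) (a / n) n)
    where
    identity : ∀ r q n → r + q * n - n * q ≡ r
    identity = solve-∀
  ρw̄ : ρ *ₑ conj w ≡ + (X % n) +ω + (Y % n)
  ρw̄ = begin
    (z -ₑ k *ₑ w) *ₑ conj w                    ≡⟨ R.distribʳ (conj w) z (-ₑ (k *ₑ w)) ⟩
    z *ₑ conj w +ₑ -ₑ (k *ₑ w) *ₑ conj w       ≡⟨ cong (_+ₑ -ₑ (k *ₑ w) *ₑ conj w) zw̄≡XY ⟩
    (X +ω Y) +ₑ -ₑ (k *ₑ w) *ₑ conj w          ≡⟨ cong ((X +ω Y) +ₑ_) (sym (-‿distribˡ-* (k *ₑ w) (conj w))) ⟩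
    (X +ω Y) -ₑ k *ₑ w *ₑ conj w               ≡⟨ cong (λ u → (X +ω Y) -ₑ u) (R.*-assoc k w (conj w)) ⟩
    (X +ω Y) -ₑ k *ₑ (w *ₑ conj w)             ≡⟨ cong (λ u → (X +ω Y) -ₑ k *ₑ u) (*ₑ-conj≡ιN w) ⟩
    (X +ω Y) -ₑ k *ₑ ι n                       ≡⟨ cong (λ u → (X +ω Y) -ₑ u) (R.*-comm k (ι n)) ⟩
    (X +ω Y) -ₑ ι n *ₑ k                       ≡⟨ cong (λ u → (X +ω Y) -ₑ u) (ι-scale n (X / n) (Y / n)) ⟩
    (X +ω Y) -ₑ (n * (X / n) +ω n * (Y / n))   ≡⟨ cong₂ _+ω_ (remainder X) (remainder Y) ⟩
    + (X % n) +ω + (Y % n)                     ∎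
    where open ≡-Reasoning
  bound : N ρ * n < n * n
  bound = begin-strict
    N ρ * n                      ≡⟨ cong (N ρ *_) (N-conj w) ⟨
    N ρ * N (conj w)             ≡⟨ N-*ₑ ρ (conj w) ⟨
    N (ρ *ₑ conj w)              ≡⟨ cong N ρw̄ ⟩
    N (+ (X % n) +ω + (Y % n))   <⟨ remainder-bound (n%d<d X n) (n%d<d Y n) ⟩
    + ∣ n ∣ * + ∣ n ∣            ≡⟨ cong₂ _*_ +∣n∣≡n +∣n∣≡n ⟩
    n * n                        ∎
    where
    open ℤ.≤-Reasoning
    +∣n∣≡n = ℤ.0≤i⇒+∣i∣≡i (0≤N w)

-- Ideals of ℤ[ω]

record IsIdeal (P : ℤ[ω] → Set) : Set where
  field
    0ₑ∈ : P 0ₑ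
    +ₑ-closed : ∀ {z w} → P z → P w → P (z +ₑ w)
    *ₑ-closed : ∀ k {z} → P z → P (k *ₑ z)

  -ₑ*ₑ-closed : ∀ k {z w} → P z → P w → P (z -ₑ k *ₑ w)
  -ₑ*ₑ-closed k {z} {w} Pz Pw = +ₑ-closed Pz (subst P (sym (-‿distribˡ-* k w)) (*ₑ-closed (-ₑ k) Pw))

∣ₑ-isIdeal : ∀ x → IsIdeal (x ∣ₑ_)
∣ₑ-isIdeal x = record { 0ₑ∈ = x ∣0 ; +ₑ-closed = ∣ₑ-+ₑ ; *ₑ-closed = λ k → x∣ʳy⇒x∣ʳzy k }

module _ {P : ℤ[ω] → Set} (P-ideal : IsIdeal P) where
  open IsIdeal P-ideal

  euclid : ∀ z w → Acc _≺_ w → P z → P w → ∃ λ g → P g × g ∣ₑ z × g ∣ₑ w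
  euclid z w (acc smaller) Pz Pw with N w ℤ.≟ 0ℤ
  ... | yes Nw≡0 = z , Pz , ∣ʳ-refl , subst (z ∣ₑ_) (sym (N≡0⇒≡0ₑ w Nw≡0)) (z ∣0)
  ... | no Nw≢0 =
    let k , ρ≺w = division z w Nw≢0
        g , Pg , g∣w , g∣ρ = euclid w (z -ₑ k *ₑ w) (smaller ρ≺w) Pw (-ₑ*ₑ-closed k Pz Pw)
    in g , Pg , subst (g ∣ₑ_) (//-rightDividesˡ (k *ₑ w) z) (∣ₑ-+ₑ g∣ρ (x∣ʳy⇒x∣ʳzy k g∣w)) , g∣w

  common-divisor : ∀ {gs} → All P gs → ∃ λ g → P g × All (g ∣ₑ_) gs
  common-divisor [] = 0ₑ , 0ₑ∈ , []
  common-divisor {g ∷ _} (Pg ∷ Pgs) =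
    let h , Ph , h∣gs = common-divisor Pgs
        d , Pd , d∣g , d∣h = euclid g h (≺-wellFounded h) Pg Ph
    in d , Pd , d∣g ∷ All.map (∣ʳ-trans d∣h) h∣gs

data ⟨_⟩ (gs : List ℤ[ω]) : ℤ[ω] → Set where
  gen   : ∀ {g} → g ∈ gs → ⟨ gs ⟩ g
  zero  : ⟨ gs ⟩ 0ₑ
  plus  : ∀ {z w} → ⟨ gs ⟩ z → ⟨ gs ⟩ w → ⟨ gs ⟩ (z +ₑ w)
  times : ∀ k {z} → ⟨ gs ⟩ z → ⟨ gs ⟩ (k *ₑ z)

⟨⟩-isIdeal : ∀ gs → IsIdeal ⟨ gs ⟩
⟨⟩-isIdeal gs = record { 0ₑ∈ = zero ; +ₑ-closed = plus ; *ₑ-closed = times }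

⟨⟩-least : ∀ {P gs} → IsIdeal P → (∀ {g} → g ∈ gs → P g) → ∀ {z} → ⟨ gs ⟩ z → P z
⟨⟩-least P-ideal gs⊆P (gen g∈gs) = gs⊆P g∈gs
⟨⟩-least P-ideal gs⊆P zero = IsIdeal.0ₑ∈ P-ideal
⟨⟩-least P-ideal gs⊆P (plus z∈ w∈) =
  IsIdeal.+ₑ-closed P-ideal (⟨⟩-least P-ideal gs⊆P z∈) (⟨⟩-least P-ideal gs⊆P w∈)
⟨⟩-least P-ideal gs⊆P (times k z∈) = IsIdeal.*ₑ-closed P-ideal k (⟨⟩-least P-ideal gs⊆P z∈)

principal : ∀ gs → ∃ λ v → ⟨ gs ⟩ v × All (v ∣ₑ_) gs
principal gs = common-divisor (⟨⟩-isIdeal gs) (All.tabulate gen)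

module _ {Q : ℤ[ω] → Set} (Q-ideal : IsIdeal Q) where
  open IsIdeal Q-ideal

  *ₑ-conj-isIdealˡ : ∀ h → IsIdeal (λ z → Q (z *ₑ conj h))
  *ₑ-conj-isIdealˡ h = record
    { 0ₑ∈ = subst Q (sym (R.zeroˡ (conj h))) 0ₑ∈
    ; +ₑ-closed = λ {z} {w} Qz Qw → subst Q (sym (R.distribʳ (conj h) z w)) (+ₑ-closed Qz Qw)
    ; *ₑ-closed = λ k {z} Qz → subst Q (sym (R.*-assoc k z (conj h))) (*ₑ-closed k Qz)
    }

  *ₑ-conj-isIdealʳ : ∀ z → IsIdeal (λ w → Q (z *ₑ conj w))
  *ₑ-conj-isIdealʳ z = record
    { 0ₑ∈ = subst Q (sym (R.zeroʳ z)) 0ₑ∈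
    ; +ₑ-closed = λ {w} {w′} Qw Qw′ →
        subst Q (sym (trans (cong (z *ₑ_) (conj-+ₑ w w′)) (R.distribˡ z (conj w) (conj w′)))) (+ₑ-closed Qw Qw′)
    ; *ₑ-closed = λ k {w} Qw →
        subst Q (sym (trans (cong (z *ₑ_) (conj-*ₑ k w)) (x∙yz≈y∙xz z (conj k) (conj w)))) (*ₑ-closed (conj k) Qw)
    }

  isotropic : ∀ {gs} → (∀ {g h} → g ∈ gs → h ∈ gs → Q (g *ₑ conj h)) →
              ∀ {z w} → ⟨ gs ⟩ z → ⟨ gs ⟩ w → Q (z *ₑ conj w)
  isotropic gs-isotropic {z} z∈ w∈ =
    ⟨⟩-least (*ₑ-conj-isIdealʳ z)
             (λ {h} h∈gs → ⟨⟩-least (*ₑ-conj-isIdealˡ h) (λ g∈gs → gs-isotropic g∈gs h∈gs) z∈) w∈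

Odd : ℤ → Set
Odd x = ∃ λ k → x ≡ + 2 * k + 1ℤ

odd-* : ∀ {x y} → Odd x → Odd y → Odd (x * y)
odd-* (j , refl) (k , refl) = + 2 * j * k + j + k , identity j k
  where
  identity : ∀ j k → (+ 2 * j + 1ℤ) * (+ 2 * k + 1ℤ) ≡ + 2 * (+ 2 * j * k + j + k) + 1ℤ
  identity = solve-∀

odd-neg : ∀ {x} → Odd x → Odd (- x)
odd-neg (k , refl) = - k - 1ℤ , identity k
  where
  identity : ∀ k → - (+ 2 * k + 1ℤ) ≡ + 2 * (- k - 1ℤ) + 1ℤ
  identity = solve-∀

odd+odd-even : ∀ {x y} → Odd x → Odd y → ∃ λ h → x + y ≡ + 2 * h
odd+odd-even (j , refl) (k , refl) = j + k + 1ℤ , identity j k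
  where
  identity : ∀ j k → + 2 * j + 1ℤ + (+ 2 * k + 1ℤ) ≡ + 2 * (j + k + 1ℤ)
  identity = solve-∀

odd≢0 : ∀ {x} → Odd x → x ≢ 0ℤ
odd≢0 (k , refl) 2k+1≡0 = 2≢1 (ℕ.∣1⇒≡1 (Signed.∣⇒∣ᵤ (Signed.divides (- k) 1≡-k*2)))
  where
  2≢1 : 2 ≢ 1
  2≢1 ()
  1≡-k*2 : 1ℤ ≡ - k * + 2
  1≡-k*2 = trans (identity k) (trans (cong (λ t → - k * + 2 + t) 2k+1≡0) (ℤ.+-identityʳ (- k * + 2)))
    where
    identity : ∀ k → 1ℤ ≡ - k * + 2 + (+ 2 * k + 1ℤ)
    identity = solve-∀

halve : ∀ {u w} → Odd u → Odd w → ∃ λ g → ι (+ 2) *ₑ g ≡ ⟪ u , w ⟫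
halve {u} {w} u-odd w-odd =
  let k , u+w≡2k = odd+odd-even u-odd w-odd
  in k +ω w , trans (ι-scale (+ 2) k w) (cong₂ _+ω_ (sym u+w≡2k) refl)

square%4≡%2 : ∀ n → n ℕ.* n ℕ.% 4 ≡ n ℕ.% 2
square%4≡%2 0 = refl
square%4≡%2 1 = refl
square%4≡%2 (suc (suc n)) = begin
  (2 ℕ.+ n) ℕ.* (2 ℕ.+ n) ℕ.% 4          ≡⟨ cong (ℕ._% 4) (identity n) ⟩
  (n ℕ.* n ℕ.+ (n ℕ.+ 1) ℕ.* 4) ℕ.% 4    ≡⟨ [m+kn]%n≡m%n (n ℕ.* n) (n ℕ.+ 1) 4 ⟩
  n ℕ.* n ℕ.% 4                          ≡⟨ square%4≡%2 n ⟩
  n ℕ.% 2                                ≡⟨ [m+kn]%n≡m%n n 1 2 ⟨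
  (n ℕ.+ 1 ℕ.* 2) ℕ.% 2                  ≡⟨ cong (ℕ._% 2) (ℕ.+-comm n 2) ⟩
  (2 ℕ.+ n) ℕ.% 2                        ∎
  where
  open ≡-Reasoning
  identity : ∀ n → (2 ℕ.+ n) ℕ.* (2 ℕ.+ n) ≡ n ℕ.* n ℕ.+ (n ℕ.+ 1) ℕ.* 4
  identity = ℕ-Solver.solve-∀

%-distribˡ-+₃ : ∀ x y z n .{{_ : ℕ.NonZero n}} →
                (x ℕ.+ y ℕ.+ z) ℕ.% n ≡ (x ℕ.% n ℕ.+ y ℕ.% n ℕ.+ z ℕ.% n) ℕ.% n
%-distribˡ-+₃ x y z n = begin
  (x ℕ.+ y ℕ.+ z) ℕ.% n
    ≡⟨ %-distribˡ-+ (x ℕ.+ y) z n ⟩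
  ((x ℕ.+ y) ℕ.% n ℕ.+ z ℕ.% n) ℕ.% n
    ≡⟨ cong (λ t → (t ℕ.+ z ℕ.% n) ℕ.% n) (%-distribˡ-+ x y n) ⟩
  ((x ℕ.% n ℕ.+ y ℕ.% n) ℕ.% n ℕ.+ z ℕ.% n) ℕ.% n
    ≡⟨ cong (λ t → ((x ℕ.% n ℕ.+ y ℕ.% n) ℕ.% n ℕ.+ t) ℕ.% n) (m%n%n≡m%n z n) ⟨
  ((x ℕ.% n ℕ.+ y ℕ.% n) ℕ.% n ℕ.+ z ℕ.% n ℕ.% n) ℕ.% n
    ≡⟨ %-distribˡ-+ (x ℕ.% n ℕ.+ y ℕ.% n) (z ℕ.% n) n ⟨
  (x ℕ.% n ℕ.+ y ℕ.% n ℕ.+ z ℕ.% n) ℕ.% n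
    ∎
  where open ≡-Reasoning

residues-odd : ∀ {r s t} → r ℕ.< 2 → s ℕ.< 2 → t ℕ.< 2 →
               (r ℕ.+ s ℕ.+ t) ℕ.% 4 ≡ 3 → r ≡ 1 × s ≡ 1 × t ≡ 1
residues-odd (s≤s (s≤s z≤n)) (s≤s (s≤s z≤n)) (s≤s (s≤s z≤n)) _ = refl , refl , refl
residues-odd (s≤s z≤n)       (s≤s z≤n)       (s≤s z≤n)       ()
residues-odd (s≤s z≤n)       (s≤s z≤n)       (s≤s (s≤s z≤n)) ()
residues-odd (s≤s z≤n)       (s≤s (s≤s z≤n)) (s≤s z≤n)       ()
residues-odd (s≤s z≤n)       (s≤s (s≤s z≤n)) (s≤s (s≤s z≤n)) ()
residues-odd (s≤s (s≤s z≤n)) (s≤s z≤n)       (s≤s z≤n)       ()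
residues-odd (s≤s (s≤s z≤n)) (s≤s z≤n)       (s≤s (s≤s z≤n)) ()
residues-odd (s≤s (s≤s z≤n)) (s≤s (s≤s z≤n)) (s≤s z≤n)       ()

%2≡1⇒odd : ∀ n → n ℕ.% 2 ≡ 1 → Odd (+ n)
%2≡1⇒odd n n%2≡1 = + (n ℕ./ 2) , trans (cong +_ n≡2k+1) (cong (_+ 1ℤ) (ℤ.pos-* 2 (n ℕ./ 2)))
  where
  identity : ∀ k → 1 ℕ.+ k ℕ.* 2 ≡ 2 ℕ.* k ℕ.+ 1
  identity = ℕ-Solver.solve-∀
  n≡2k+1 : n ≡ 2 ℕ.* (n ℕ./ 2) ℕ.+ 1
  n≡2k+1 = trans (m≡m%n+[m/n]*n n 2) (trans (cong (ℕ._+ n ℕ./ 2 ℕ.* 2) n%2≡1) (identity (n ℕ./ 2)))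

∣∣%2≡1⇒odd : ∀ x → ∣ x ∣ ℕ.% 2 ≡ 1 → Odd x
∣∣%2≡1⇒odd x ∣x∣%2≡1 with ℤ.+∣i∣≡i⊎+∣i∣≡-i x
... | inj₁ +∣x∣≡x = subst Odd +∣x∣≡x (%2≡1⇒odd ∣ x ∣ ∣x∣%2≡1)
... | inj₂ +∣x∣≡-x =
  subst Odd (ℤ.neg-involutive x) (odd-neg (subst Odd +∣x∣≡-x (%2≡1⇒odd ∣ x ∣ ∣x∣%2≡1)))

¬2∣⇒∣∣%2≡1 : ∀ x → ¬ (+ 2 ∣ x) → ∣ x ∣ ℕ.% 2 ≡ 1
¬2∣⇒∣∣%2≡1 x 2∤x with ∣ x ∣ ℕ.% 2 in ∣x∣%2≡r | m%n<n ∣ x ∣ 2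
... | 0           | _ = ⊥-elim (2∤x (ℕ.m%n≡0⇒n∣m ∣ x ∣ 2 ∣x∣%2≡r))
... | 1           | _ = refl
... | suc (suc _) | s≤s (s≤s ())

abs-three-squares : ∀ {a b c d} → a * a + b * b + c * c ≡ + 3 * (d * d) →
                    ∣ a ∣ ℕ.* ∣ a ∣ ℕ.+ ∣ b ∣ ℕ.* ∣ b ∣ ℕ.+ ∣ c ∣ ℕ.* ∣ c ∣ ≡ 3 ℕ.* (∣ d ∣ ℕ.* ∣ d ∣)
abs-three-squares {a} {b} {c} {d} three-squares = ℤ.+-injective (begin
  + (∣ a ∣ ℕ.* ∣ a ∣) + + (∣ b ∣ ℕ.* ∣ b ∣) + + (∣ c ∣ ℕ.* ∣ c ∣)
    ≡⟨ cong₂ _+_ (cong₂ _+_ (square-abs a) (square-abs b)) (square-abs c) ⟩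
  a * a + b * b + c * c      ≡⟨ three-squares ⟩
  + 3 * (d * d)              ≡⟨ cong (+ 3 *_) (square-abs d) ⟨
  + 3 * + (∣ d ∣ ℕ.* ∣ d ∣)  ≡⟨ ℤ.pos-* 3 (∣ d ∣ ℕ.* ∣ d ∣) ⟨
  + (3 ℕ.* (∣ d ∣ ℕ.* ∣ d ∣)) ∎)
  where open ≡-Reasoning

three-squares-odd : ∀ {a b c d} → a * a + b * b + c * c ≡ + 3 * (d * d) → ¬ (+ 2 ∣ d) →
                    Odd a × Odd b × Odd c × Odd d
three-squares-odd {a} {b} {c} {d} three-squares 2∤d =
  let A%2≡1 , B%2≡1 , C%2≡1 = residues-odd (m%n<n A 2) (m%n<n B 2) (m%n<n C 2) residues
  in ∣∣%2≡1⇒odd a A%2≡1 , ∣∣%2≡1⇒odd b B%2≡1 , ∣∣%2≡1⇒odd c C%2≡1 , ∣∣%2≡1⇒odd d D%2≡1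
  where
  A = ∣ a ∣
  B = ∣ b ∣
  C = ∣ c ∣
  D = ∣ d ∣
  D%2≡1 : D ℕ.% 2 ≡ 1
  D%2≡1 = ¬2∣⇒∣∣%2≡1 d 2∤d
  residues : (A ℕ.% 2 ℕ.+ B ℕ.% 2 ℕ.+ C ℕ.% 2) ℕ.% 4 ≡ 3
  residues = begin
    (A ℕ.% 2 ℕ.+ B ℕ.% 2 ℕ.+ C ℕ.% 2) ℕ.% 4
      ≡⟨ cong (ℕ._% 4) (cong₂ ℕ._+_ (cong₂ ℕ._+_ (square%4≡%2 A) (square%4≡%2 B)) (square%4≡%2 C)) ⟨
    (A ℕ.* A ℕ.% 4 ℕ.+ B ℕ.* B ℕ.% 4 ℕ.+ C ℕ.* C ℕ.% 4) ℕ.% 4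
      ≡⟨ %-distribˡ-+₃ (A ℕ.* A) (B ℕ.* B) (C ℕ.* C) 4 ⟨
    (A ℕ.* A ℕ.+ B ℕ.* B ℕ.+ C ℕ.* C) ℕ.% 4
      ≡⟨ cong (ℕ._% 4) (abs-three-squares {a} {b} {c} {d} three-squares) ⟩
    3 ℕ.* (D ℕ.* D) ℕ.% 4                    ≡⟨ %-distribˡ-* 3 (D ℕ.* D) 4 ⟩
    3 ℕ.* (D ℕ.* D ℕ.% 4) ℕ.% 4              ≡⟨ cong (λ r → 3 ℕ.* r ℕ.% 4) (trans (square%4≡%2 D) D%2≡1) ⟩
    3                                        ∎
    where open ≡-Reasoning

prime-divisor : ∀ n → n ≢ 1 → ∃ λ p → Prime p × p ℕ.∣ n
prime-divisor 0 _ = 2 , prime[2] , 2 ℕ.∣0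
prime-divisor (suc n) 1+n≢1 with factorise (suc n)
... | record { factors = [] ; isFactorisation = 1+n≡1 } = ⊥-elim (1+n≢1 1+n≡1)
... | record { factors = p ∷ ps ; isFactorisation = 1+n≡p*ps ; factorsPrime = p-prime ∷ _ } =
  p , p-prime , ℕ.divides (product ps) (trans 1+n≡p*ps (ℕ.*-comm p (product ps)))

prime∣square⇒∣ : ∀ {p n} → Prime p → p ℕ.∣ n ℕ.* n → p ℕ.∣ n
prime∣square⇒∣ {n = n} p-prime p∣n² with euclidsLemma n n p-prime p∣n²
... | inj₁ p∣n = p∣n
... | inj₂ p∣n = p∣n

coprime-squares : ∀ {a b c t} → gcd (gcd a b) c ≡ 1ℤ →
                  t ∣ a * a → t ∣ b * b → t ∣ c * c → ∣ t ∣ ≡ 1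
coprime-squares {a} {b} {c} {t} coprime t∣a² t∣b² t∣c² = decidable-stable (∣ t ∣ ℕ.≟ 1) λ ∣t∣≢1 →
  let p , p-prime , p∣t = prime-divisor ∣ t ∣ ∣t∣≢1
      p∣ : ∀ x → t ∣ x * x → + p ∣ x
      p∣ x t∣x² = prime∣square⇒∣ p-prime (ℕ.∣-trans p∣t (subst (∣ t ∣ ℕ.∣_) (ℤ.abs-* x x) t∣x²))
      p∣gcd = gcd-greatest {gcd a b} {c} {+ p}
                (gcd-greatest {a} {b} {+ p} (p∣ a t∣a²) (p∣ b t∣b²)) (p∣ c t∣c²)
  in nonTrivial⇒≢1 {{prime⇒nonTrivial p-prime}} (ℕ.∣1⇒≡1 (subst (λ g → + p ∣ g) coprime p∣gcd))

half-sums : ∀ {x y z p r s} → x + y ≡ + 2 * p → x + z ≡ + 2 * r → y + z ≡ + 2 * s → x ≡ p + r - s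
half-sums {x} {y} {z} {p} {r} {s} x+y≡2p x+z≡2r y+z≡2s = ℤ.*-cancelˡ-≡ (+ 2) x (p + r - s) (begin
  + 2 * x                           ≡⟨ identity₁ x y z ⟩
  x + y + (x + z) - (y + z)         ≡⟨ cong₂ _-_ (cong₂ _+_ x+y≡2p x+z≡2r) y+z≡2s ⟩
  + 2 * p + + 2 * r - + 2 * s       ≡⟨ identity₂ p r s ⟩
  + 2 * (p + r - s)                 ∎)
  where
  open ≡-Reasoning
  identity₁ : ∀ x y z → + 2 * x ≡ x + y + (x + z) - (y + z)
  identity₁ = solve-∀
  identity₂ : ∀ p r s → + 2 * p + + 2 * r - + 2 * s ≡ + 2 * (p + r - s)
  identity₂ = solve-∀

-- The ideal (m, g₁, g₂)

module Construction
  (a b c d m α β : ℤ) (g₁ g₂ h : ℤ[ω])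
  (three-squares : a * a + b * b + c * c ≡ + 3 * (d * d))
  (coprime : gcd (gcd a b) c ≡ 1ℤ)
  (a≢0 : a ≢ 0ℤ)
  (2m≡ : a * a + b * b ≡ + 2 * m)
  (2α≡ : a * a + c * c ≡ + 2 * α)
  (2β≡ : b * b + c * c ≡ + 2 * β)
  (2g₁≡ : ι (+ 2) *ₑ g₁ ≡ ⟪ b * c , a * d ⟫)
  (2g₂≡ : ι (+ 2) *ₑ g₂ ≡ ⟪ - (a * c) , b * d ⟫)
  (2h≡ : ι (+ 2) *ₑ h ≡ ⟪ a * b , - (c * d) ⟫)
  where

  open ≡-Reasoning

  Δ≡0 : + 3 * (d * d) - (a * a + b * b + c * c) ≡ 0ℤ
  Δ≡0 = trans (cong (_- (a * a + b * b + c * c)) (sym three-squares)) (ℤ.+-inverseʳ (a * a + b * b + c * c))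

  by-three-squares : ∀ {L} R k → L ≡ R + k * (+ 3 * (d * d) - (a * a + b * b + c * c)) → L ≡ R
  by-three-squares {L} R k L≡R+kΔ = begin
    L                                                 ≡⟨ L≡R+kΔ ⟩
    R + k * (+ 3 * (d * d) - (a * a + b * b + c * c)) ≡⟨ cong (λ Δ → R + k * Δ) Δ≡0 ⟩
    R + k * 0ℤ                                        ≡⟨ cong (λ t → R + t) (ℤ.*-zeroʳ k) ⟩
    R + 0ℤ                                            ≡⟨ ℤ.+-identityʳ R ⟩
    R                                                 ∎

  N-g₁ : N g₁ ≡ m * α
  N-g₁ = N-half≡ g₁ (b * c) (a * d) {m} {α} 2g₁≡
           (trans (by-three-squares ((a * a + b * b) * (a * a + c * c)) (a * a) (identity a b c d))
                  (cong₂ _*_ 2m≡ 2α≡))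
    where
    identity : ∀ a b c d → b * c * (b * c) + + 3 * (a * d * (a * d))
                         ≡ (a * a + b * b) * (a * a + c * c) + a * a * (+ 3 * (d * d) - (a * a + b * b + c * c))
    identity = solve-∀

  N-g₂ : N g₂ ≡ m * β
  N-g₂ = N-half≡ g₂ (- (a * c)) (b * d) {m} {β} 2g₂≡
           (trans (by-three-squares ((a * a + b * b) * (b * b + c * c)) (b * b) (identity a b c d))
                  (cong₂ _*_ 2m≡ 2β≡))
    where
    identity : ∀ a b c d → - (a * c) * - (a * c) + + 3 * (b * d * (b * d))
                         ≡ (a * a + b * b) * (b * b + c * c) + b * b * (+ 3 * (d * d) - (a * a + b * b + c * c))
    identity = solve-∀

  g₁ḡ₂ : g₁ *ₑ conj g₂ ≡ ι m *ₑ h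
  g₁ḡ₂ = ι-*ₑ-cancel {+ 4} (g₁ *ₑ conj g₂) (ι m *ₑ h) (λ ()) (begin
    ι (+ 4) *ₑ (g₁ *ₑ conj g₂)                          ≡⟨ double-*ₑ g₁ (conj g₂) ⟨
    ι (+ 2) *ₑ g₁ *ₑ (ι (+ 2) *ₑ conj g₂)               ≡⟨ cong (ι (+ 2) *ₑ g₁ *ₑ_) (conj-double g₂) ⟨
    ι (+ 2) *ₑ g₁ *ₑ conj (ι (+ 2) *ₑ g₂)               ≡⟨ cong₂ (λ u w → u *ₑ conj w) 2g₁≡ 2g₂≡ ⟩
    ⟪ b * c , a * d ⟫ *ₑ conj ⟪ - (a * c) , b * d ⟫     ≡⟨ ⟪⟫-*ₑ-conj (b * c) (a * d) (- (a * c)) (b * d) ⟩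
    ⟪ b * c * - (a * c) + + 3 * (a * d * (b * d)) , a * d * - (a * c) - b * c * (b * d) ⟫
      ≡⟨ cong₂ ⟪_,_⟫ (by-three-squares ((a * a + b * b) * (a * b)) (a * b) (re-eq a b c d)) (im-eq a b c d) ⟩
    ⟪ (a * a + b * b) * (a * b) , (a * a + b * b) * - (c * d) ⟫
                                                        ≡⟨ ι-⟪⟫ (a * a + b * b) (a * b) (- (c * d)) ⟨
    ι (a * a + b * b) *ₑ ⟪ a * b , - (c * d) ⟫          ≡⟨ cong₂ (λ k u → ι k *ₑ u) 2m≡ (sym 2h≡) ⟩
    ι (+ 2 * m) *ₑ (ι (+ 2) *ₑ h)                       ≡⟨ cong (_*ₑ (ι (+ 2) *ₑ h)) (ι-* (+ 2) m) ⟩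
    ι (+ 2) *ₑ ι m *ₑ (ι (+ 2) *ₑ h)                    ≡⟨ interchange (ι (+ 2)) (ι m) (ι (+ 2)) h ⟩
    ι (+ 4) *ₑ (ι m *ₑ h)                               ∎)
    where
    re-eq : ∀ a b c d → b * c * - (a * c) + + 3 * (a * d * (b * d))
                      ≡ (a * a + b * b) * (a * b) + a * b * (+ 3 * (d * d) - (a * a + b * b + c * c))
    re-eq = solve-∀
    im-eq : ∀ a b c d → a * d * - (a * c) - b * c * (b * d) ≡ (a * a + b * b) * - (c * d)
    im-eq = solve-∀

  generators : List ℤ[ω]
  generators = ι m ∷ g₁ ∷ g₂ ∷ []

  m∣gḡ : ∀ {g g′} → g ∈ generators → g′ ∈ generators → ι m ∣ₑ g *ₑ conj g′
  m∣gḡ {g′ = g′} (here refl) _ = conj g′ , R.*-comm (conj g′) (ι m)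
  m∣gḡ {g} _ (here refl) = g , cong (g *ₑ_) (sym (conj-ι m))
  m∣gḡ (there (here refl)) (there (here refl)) =
    ∣N⇒ι∣*ₑ-conj g₁ (Signed.divides α (trans N-g₁ (ℤ.*-comm m α)))
  m∣gḡ (there (here refl)) (there (there (here refl))) = h , trans (R.*-comm h (ι m)) (sym g₁ḡ₂)
  m∣gḡ (there (there (here refl))) (there (here refl)) =
    subst (ι m ∣ₑ_) (conj-*ₑ-conj g₁ g₂) (ι∣⇒ι∣conj (g₁ *ₑ conj g₂) (h , trans (R.*-comm h (ι m)) (sym g₁ḡ₂)))
  m∣gḡ (there (there (here refl))) (there (there (here refl))) =
    ∣N⇒ι∣*ₑ-conj g₂ (Signed.divides β (trans N-g₂ (ℤ.*-comm m β)))
  m∣gḡ (there (there (there ()))) _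
  m∣gḡ _ (there (there (there ())))

  m≢0 : m ≢ 0ℤ
  m≢0 m≡0 = a≢0 (i*i≡0⇒i≡0 a (nonneg-+≡0⇒≡0 (0≤i*i a) (0≤i*i b) (trans 2m≡ (cong (+ 2 *_) m≡0))))

  0≤m : 0ℤ ≤ m
  0≤m = ℤ.*-cancelˡ-≤-pos 0ℤ m (+ 2) (subst (0ℤ ≤_) 2m≡ (ℤ.+-mono-≤ (0≤i*i a) (0≤i*i b)))

  N-quotient-∣ : ∀ v t g {n} → N v ≡ t * m → v ∣ₑ g → N g ≡ n * m → t Signed.∣ n
  N-quotient-∣ v t g Nv≡tm v∣g Ng≡nm =
    Signed.*-cancelʳ-∣ m {{≢-nonZero m≢0}} (subst₂ Signed._∣_ Nv≡tm Ng≡nm (N-∣ g v∣g))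

  m∣N : ∀ v → ⟨ generators ⟩ v → m Signed.∣ N v
  m∣N v v∈ = proj₁ (ι∣⇒∣components (N v) 0ℤ
                      (subst (ι m ∣ₑ_) (*ₑ-conj≡ιN v) (isotropic (∣ₑ-isIdeal (ι m)) m∣gḡ v∈ v∈)))

  quotient-unit : ∀ v t → N v ≡ t * m → All (v ∣ₑ_) generators → ∣ t ∣ ≡ 1
  quotient-unit v t Nv≡tm (v∣m ∷ v∣g₁ ∷ v∣g₂ ∷ []) =
    coprime-squares {a} {b} {c} {t} coprime (t∣ t∣m t∣α t∣β a²≡) (t∣ t∣m t∣β t∣α b²≡) (t∣ t∣α t∣β t∣m c²≡)
    where
    t∣m : t Signed.∣ m
    t∣m = N-quotient-∣ v t (ι m) Nv≡tm v∣m (N-ι m)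
    t∣α : t Signed.∣ α
    t∣α = N-quotient-∣ v t g₁ Nv≡tm v∣g₁ (trans N-g₁ (ℤ.*-comm m α))
    t∣β : t Signed.∣ β
    t∣β = N-quotient-∣ v t g₂ Nv≡tm v∣g₂ (trans N-g₂ (ℤ.*-comm m β))
    a²≡ : a * a ≡ m + α - β
    a²≡ = half-sums 2m≡ 2α≡ 2β≡
    b²≡ : b * b ≡ m + β - α
    b²≡ = half-sums (trans (ℤ.+-comm (b * b) (a * a)) 2m≡) 2β≡ 2α≡
    c²≡ : c * c ≡ α + β - m
    c²≡ = half-sums (trans (ℤ.+-comm (c * c) (a * a)) 2α≡) (trans (ℤ.+-comm (c * c) (b * b)) 2β≡) 2m≡
    t∣ : ∀ {x y z s} → t Signed.∣ x → t Signed.∣ y → t Signed.∣ z → s ≡ x + y - z → t ∣ s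
    t∣ t∣x t∣y t∣z s≡ =
      Signed.∣⇒∣ᵤ (subst (t Signed.∣_) (sym s≡) (Signed.∣m∣n⇒∣m-n (Signed.∣m∣n⇒∣m+n t∣x t∣y) t∣z))

  N≡m : ∀ v → ⟨ generators ⟩ v → All (v ∣ₑ_) generators → N v ≡ m
  N≡m v v∈ v∣generators = from-quotient (m∣N v v∈)
    where
    from-quotient : m Signed.∣ N v → N v ≡ m
    from-quotient (Signed.divides t Nv≡tm) = begin
      N v                       ≡⟨ ℤ.0≤i⇒+∣i∣≡i (0≤N v) ⟨
      + ∣ N v ∣                 ≡⟨ cong (λ n → + ∣ n ∣) Nv≡tm ⟩
      + ∣ t * m ∣               ≡⟨ cong +_ (ℤ.abs-* t m) ⟩
      + (∣ t ∣ ℕ.* ∣ m ∣)       ≡⟨ cong (λ n → + (n ℕ.* ∣ m ∣)) (quotient-unit v t Nv≡tm v∣generators) ⟩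
      + (1 ℕ.* ∣ m ∣)           ≡⟨ cong +_ (ℕ.*-identityˡ ∣ m ∣) ⟩
      + ∣ m ∣                   ≡⟨ ℤ.0≤i⇒+∣i∣≡i 0≤m ⟩
      m                         ∎

  q∣Gv̄ : ∀ g {G} v → ι (+ 2) *ₑ g ≡ G → ι m ∣ₑ g *ₑ conj v → ι (a * a + b * b) ∣ₑ G *ₑ conj v
  q∣Gv̄ g {G} v 2g≡G m∣gv̄ =
    subst₂ _∣ₑ_ (trans (sym (ι-* (+ 2) m)) (cong ι (sym 2m≡)))
                (trans (sym (R.*-assoc (ι (+ 2)) g (conj v))) (cong (_*ₑ conj v) 2g≡G))
                (x∣y⇒zx∣zy (ι (+ 2)) m∣gv̄)

  Solution : ℤ[ω] → Set
  Solution v = a * a + b * b ≡ + 2 * N v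
             × ι (a * a + b * b) ∣ₑ ⟪ b * c , a * d ⟫ *ₑ conj v
             × ι (a * a + b * b) ∣ₑ ⟪ - (a * c) , b * d ⟫ *ₑ conj v

  generator-solution : ∀ v → ⟨ generators ⟩ v → All (v ∣ₑ_) generators → Solution v
  generator-solution v v∈ v∣generators =
    trans 2m≡ (cong (+ 2 *_) (sym (N≡m v v∈ v∣generators))) ,
    q∣Gv̄ g₁ v 2g₁≡ (m∣gv̄ (there (here refl))) ,
    q∣Gv̄ g₂ v 2g₂≡ (m∣gv̄ (there (there (here refl))))
    where
    m∣gv̄ : ∀ {g} → g ∈ generators → ι m ∣ₑ g *ₑ conj v
    m∣gv̄ {g} g∈ = subst (ι m ∣ₑ_) (conj-*ₑ-conj v g)
                    (ι∣⇒ι∣conj (v *ₑ conj g) (isotropic (∣ₑ-isIdeal (ι m)) m∣gḡ v∈ (gen g∈)))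

  solution : ∃ Solution
  solution = let v , v∈ , v∣generators = principal generators in v , generator-solution v v∈ v∣generators

Conditions : (a b c d r s : ℤ) → Set
Conditions a b c d r s =
  let q = a * a + b * b in
  (+ 2 * q ≡ s * s + + 3 * (r * r)) ×
  (+ 2 * q ∣ - (d * b * (+ 3 * r + s) + a * c * (r - s))) ×
  (q ∣ - (r * a * c + d * b * s)) ×
  (+ 2 * q ∣ d * a * (+ 3 * r + s) - b * c * (r - s)) ×
  (q ∣ d * a * s - b * c * r) ×
  (+ 2 ∣ r - s) ×
  (1ℤ ∣ r) ×
  (q ∣ - (r * a * c + d * b * s)) ×
  (+ 2 * q ∣ - (d * b * (s - + 3 * r) + a * c * (r + s))) ×
  (q ∣ d * a * s - r * b * c) ×
  (+ 2 * q ∣ d * a * (s - + 3 * r) - b * c * (r + s)) ×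
  (1ℤ ∣ r) ×
  (+ 2 ∣ r + s)

conditions : ∀ a b c d x y → a * a + b * b ≡ + 2 * N (x +ω y) →
             ι (a * a + b * b) ∣ₑ ⟪ b * c , a * d ⟫ *ₑ conj (x +ω y) →
             ι (a * a + b * b) ∣ₑ ⟪ - (a * c) , b * d ⟫ *ₑ conj (x +ω y) →
             Conditions a b c d y (+ 2 * x - y)
conditions a b c d x y q≡2Nv q∣G₁v̄ q∣G₂v̄ =
  let q∣W₁ , 2q∣U₁+W₁ , 2q∣W₁-U₁ = ⟪⟫-*ₑ-conj-∣ (b * c) (a * d) (x +ω y) s y (2z≡⟪⟫ x y) q∣G₁v̄
      q∣W₂ , 2q∣U₂+W₂ , 2q∣W₂-U₂ = ⟪⟫-*ₑ-conj-∣ (- (a * c)) (b * d) (x +ω y) s y (2z≡⟪⟫ x y) q∣G₂v̄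
      n-x = ∣-subst (cong -_ (n-x≡W₂ a b c d y s)) (Signed.∣m⇒∣-m q∣W₂)
  in norm ,
     ∣-subst (cong -_ (m-x≡U₂+W₂ a b c d y s)) (Signed.∣m⇒∣-m 2q∣U₂+W₂) ,
     n-x ,
     ∣-subst (m-y≡U₁+W₁ a b c d y s) 2q∣U₁+W₁ ,
     ∣-subst (n-y≡W₁ a b c d y s) q∣W₁ ,
     ∣-subst (identity₁ x y) (Signed.divides (y - x) refl) ,
     1∣y ,
     n-x ,
     ∣-subst (cong -_ (n-u≡W₂-U₂ a b c d y s)) (Signed.∣m⇒∣-m 2q∣W₂-U₂) ,
     ∣-subst (m-v≡W₁ a b c d y s) q∣W₁ ,
     ∣-subst (n-v≡W₁-U₁ a b c d y s) 2q∣W₁-U₁ ,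
     1∣y ,
     ∣-subst (identity₂ x y) (Signed.divides x refl)
  where
  s = + 2 * x - y
  ∣-subst : ∀ {k i j} → i ≡ j → k Signed.∣ j → k ∣ i
  ∣-subst {k} i≡j k∣j = Signed.∣⇒∣ᵤ (subst (k Signed.∣_) (sym i≡j) k∣j)
  1∣y : 1ℤ ∣ y
  1∣y = ℕ.1∣ ∣ y ∣
  norm : + 2 * (a * a + b * b) ≡ s * s + + 3 * (y * y)
  norm = trans (cong (+ 2 *_) q≡2Nv) (trans (identity₀ (N (x +ω y))) (N-half (x +ω y) s y (2z≡⟪⟫ x y)))
    where
    identity₀ : ∀ n → + 2 * (+ 2 * n) ≡ + 4 * n
    identity₀ = solve-∀
  identity₁ : ∀ x y → y - (+ 2 * x - y) ≡ (y - x) * + 2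
  identity₁ = solve-∀
  identity₂ : ∀ x y → y + (+ 2 * x - y) ≡ x * + 2
  identity₂ = solve-∀
  m-x≡U₂+W₂ : ∀ a b c d r s → d * b * (+ 3 * r + s) + a * c * (r - s)
                            ≡ - (a * c) * s + + 3 * (b * d * r) + (b * d * s - - (a * c) * r)
  m-x≡U₂+W₂ = solve-∀
  n-x≡W₂ : ∀ a b c d r s → r * a * c + d * b * s ≡ b * d * s - - (a * c) * r
  n-x≡W₂ = solve-∀
  m-y≡U₁+W₁ : ∀ a b c d r s → d * a * (+ 3 * r + s) - b * c * (r - s)
                            ≡ b * c * s + + 3 * (a * d * r) + (a * d * s - b * c * r)
  m-y≡U₁+W₁ = solve-∀
  n-y≡W₁ : ∀ a b c d r s → d * a * s - b * c * r ≡ a * d * s - b * c * r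
  n-y≡W₁ = solve-∀
  n-u≡W₂-U₂ : ∀ a b c d r s → d * b * (s - + 3 * r) + a * c * (r + s)
                            ≡ b * d * s - - (a * c) * r - (- (a * c) * s + + 3 * (b * d * r))
  n-u≡W₂-U₂ = solve-∀
  m-v≡W₁ : ∀ a b c d r s → d * a * s - r * b * c ≡ a * d * s - b * c * r
  m-v≡W₁ = solve-∀
  n-v≡W₁-U₁ : ∀ a b c d r s → d * a * (s - + 3 * r) - b * c * (r + s)
                            ≡ a * d * s - b * c * r - (b * c * s + + 3 * (a * d * r))
  n-v≡W₁-U₁ = solve-∀

proposition6p3 : (a b c d : ℤ) →
    a * a + b * b + c * c ≡ + 3 * (d * d) →
    0ℤ < d → ¬ (+ 2 ∣ d) →
    gcd (gcd a b) c ≡ 1ℤ →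
    let q = a * a + b * b in
    ∃₂ λ (r s : ℤ) →
      (+ 2 * q ≡ s * s + + 3 * (r * r)) ×
      -- m_x
      (+ 2 * q ∣ - (d * b * (+ 3 * r + s) + a * c * (r - s))) ×
      -- n_x
      (q ∣ - (r * a * c + d * b * s)) ×
      -- m_y
      (+ 2 * q ∣ d * a * (+ 3 * r + s) - b * c * (r - s)) ×
      -- n_y
      (q ∣ d * a * s - b * c * r) ×
      -- m_z
      (+ 2 ∣ r - s) ×
      -- n_z
      (1ℤ ∣ r) ×
      -- m_u
      (q ∣ - (r * a * c + d * b * s)) ×
      -- n_u
      (+ 2 * q ∣ - (d * b * (s - + 3 * r) + a * c * (r + s))) ×
      -- m_v
      (q ∣ d * a * s - r * b * c) ×
      -- n_v
      (+ 2 * q ∣ d * a * (s - + 3 * r) - b * c * (r + s)) ×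
      -- m_w
      (1ℤ ∣ r) ×
      -- n_w
      (+ 2 ∣ r + s)
proposition6p3 a b c d three-squares _ 2∤d coprime =
  let a-odd , b-odd , c-odd , d-odd = three-squares-odd three-squares 2∤d
      m , 2m≡ = odd+odd-even (odd-* a-odd a-odd) (odd-* b-odd b-odd)
      α , 2α≡ = odd+odd-even (odd-* a-odd a-odd) (odd-* c-odd c-odd)
      β , 2β≡ = odd+odd-even (odd-* b-odd b-odd) (odd-* c-odd c-odd)
      g₁ , 2g₁≡ = halve (odd-* b-odd c-odd) (odd-* a-odd d-odd)
      g₂ , 2g₂≡ = halve (odd-neg (odd-* a-odd c-odd)) (odd-* b-odd d-odd)
      h , 2h≡ = halve (odd-* a-odd b-odd) (odd-neg (odd-* c-odd d-odd))
      x +ω y , q≡2Nv , q∣G₁v̄ , q∣G₂v̄ =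
        Construction.solution a b c d m α β g₁ g₂ h three-squares coprime (odd≢0 a-odd)
                              2m≡ 2α≡ 2β≡ 2g₁≡ 2g₂≡ 2h≡
  in y , + 2 * x - y , conditions a b c d x y q≡2Nv q∣G₁v̄ q∣G₂v̄
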